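{- Let $G$ be a finite abelian group of order $N$, and let $e = \exp G$ be the exponent of $G$ (the least common multiple of the orders of the elements of $G$). For $1 \leq r \leq N$, define \[D(N, e, r) = \{d_1 d_2 \mid d_1 \in D(N/e),\ d_2 \in D(e),\ d_1 e \geq r\},\] where $D(n)$ denotes the set of positive divisors of $n$. Then \[\rho_G^-(r) \leq \min_{d \in D(N, e, r)} d \left(2\left\lceil\frac{r}{d}\right\rceil - 1\right).\]
   Context: For subsets $A,B$ of an abelian group $G$, $A - B = \{a - b \mid a \in A, b \in B\}$. For a finite abelian group $G$ of order $N$ and $1 \leq r \leq N$, $\rho_G^-(r) = \min\{|A - A| \mid A \subseteq G, |A| = r\}$. -}

module Defs where

open import Level using (Level)
open import Algebra.Bundles using (AbelianGroup)
open import Data.Nat using (ℕ; zero; suc; _+_; _*_; _∸_; _≤_; _<_)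
open import Data.Nat.DivMod using (_/_)
open import Data.Nat.LCM using (lcm)
open import Data.Nat.Divisibility using (_∣_)
open import Data.Fin using (Fin)
open import Data.Product using (Σ; _×_; ∃)
open import Data.List using (List; foldr; map)
open import Data.List using () renaming (allFin to allFinL)
open import Relation.Binary.PropositionalEquality using (_≡_)
open import Relation.Nullary using (¬_)

module _ {c ℓ : Level} (G : AbelianGroup c ℓ) where
  open AbelianGroup G

  sub : Carrier → Carrier → Carrier
  sub a b = a ∙ (b ⁻¹)

  times : ℕ → Carrier → Carrier
  times zero    g = ε
  times (suc n) g = g ∙ times n g

  record HasOrder (N : ℕ) : Set (c Level.⊔ ℓ) where
    field
      enum      : Fin N → Carrier
      enum-inj  : ∀ i j → enum i ≈ enum j → i ≡ j
      enum-surj : ∀ x → ∃ λ i → x ≈ enum i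

  IsElemOrder : Carrier → ℕ → Set ℓ
  IsElemOrder g n = (0 < n) × (times n g ≈ ε) × (∀ m → 0 < m → m < n → ¬ (times m g ≈ ε))

  -- A subset A ⊆ G of size r, given by an injective listing a : Fin r → G
  IsSubsetOfSize : (r : ℕ) → (Fin r → Carrier) → Set ℓ
  IsSubsetOfSize r a = ∀ i j → a i ≈ a j → i ≡ j

  -- |A - A| ≤ k : the difference set is covered by k elements of G
  DiffSetAtMost : {r : ℕ} → (Fin r → Carrier) → ℕ → Set (c Level.⊔ ℓ)
  DiffSetAtMost {r} a k =
    Σ (Fin k → Carrier) λ f → ∀ i j → ∃ λ t → sub (a i) (a j) ≈ f t

  -- ρ_G^-(r) ≤ k  (ρ is a minimum over subsets of size r)
  RhoMinusAtMost : ℕ → ℕ → Set (c Level.⊔ ℓ)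
  RhoMinusAtMost r k =
    Σ (Fin r → Carrier) λ a → IsSubsetOfSize r a × DiffSetAtMost a k

lcmList : List ℕ → ℕ
lcmList = foldr lcm 1

lcmFin : (N : ℕ) → (Fin N → ℕ) → ℕ
lcmFin N o = lcmList (map o (allFinL N))

-- truncated division (n / 0 := 0; only used with nonzero divisor)
_div_ : ℕ → ℕ → ℕ
n div zero    = zero
n div (suc m) = n / suc m

-- ⌈ r / d ⌉ for d ≥ 1 (0 when d = 0)
ceilDiv : ℕ → ℕ → ℕ
ceilDiv r zero    = zero
ceilDiv r (suc k) = (r + k) / suc k

_∈D_ : ℕ → ℕ → Set
d ∈D n = (1 ≤ d) × (d ∣ n)

module Submission where

-- Let x be an element of maximal order M; its order is the exponent e, and we write
-- M = μ d₂.  Since d₁ M ∣ N we can build, one prime factor of d₁ at a time and using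
-- Lagrange and Cauchy, a subgroup K of size d₁ meeting ⟨x⟩ only in 0, and put
-- H = K + ⟨μ x⟩: a subgroup of size d modulo which x has order μ.  The first r
-- elements of the rows H, H + x, H + 2x, … form a set A inside H + {0, …, m - 1} x,
-- m = ⌈r/d⌉ (there is room since r ≤ d₁ e = μ d), so A - A lies in
-- H + {-(m - 1), …, m - 1} x, a set of at most d (2m - 1) elements.

open import Defs
open import Level using (Level)
open import Algebra.Bundles using (AbelianGroup)
open import Data.Nat using (ℕ; _*_; _∸_; _≤_)
open import Data.Fin using (Fin)
open import Relation.Binary.PropositionalEquality using (_≡_)

open import Level using () renaming (_⊔_ to _⊔ˡ_)
open import Data.Nat hiding (_⊔_)
open import Data.Nat.Properties
open import Data.Nat.Divisibility
open import Data.Nat.DivMod hiding (_div_)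
open import Data.Nat.GCD using (gcd; gcd[m,n]∣m; gcd[m,n]∣n; gcd-greatest; module Bézout)
open import Data.Nat.LCM using (m∣lcm[m,n]; n∣lcm[m,n]; lcm-least)
open import Data.Nat.Coprimality as Coprime using (Coprime; coprime-divisor; coprime-Bézout; prime⇒coprime)
open import Data.Nat.Primality using (Prime; prime⇒irreducible; prime⇒nonTrivial)
open import Data.Nat.Primality.Factorisation using (PrimeFactorisation; factorise)
open import Data.Nat.ListAction using (product)
open import Data.Nat.Tactic.RingSolver using (solve-∀)
open import Data.Fin using (zero; suc; toℕ; fromℕ<; combine; remQuot; inject≤)
import Data.Fin.Properties as FinP
open import Data.List using ([]; _∷_; map; allFin)
open import Data.List.Membership.Propositional using (_∈_)
open import Data.List.Membership.Propositional.Properties using (∈-map⁺; ∈-map⁻; ∈-allFin)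
open import Data.List.Relation.Unary.Any using (here; there)
open import Data.List.Relation.Unary.All using (All; []; _∷_)
open import Data.Product using (∃; _×_; _,_; proj₁; proj₂; uncurry)
open import Data.Sum using (_⊎_; inj₁; inj₂)
open import Relation.Nullary using (¬_; Dec; yes; no; contradiction)
open import Relation.Nullary.Decidable using (_×-dec_)
open import Relation.Binary.PropositionalEquality as ≡ using (_≢_; refl; cong; cong₂; subst; subst₂)

pos∧≢1⇒≥2 : ∀ {n} → 0 < n → n ≢ 1 → 2 ≤ n
pos∧≢1⇒≥2 {suc zero}    _ n≢1 = contradiction refl n≢1
pos∧≢1⇒≥2 {suc (suc _)} _ _   = s≤s (s≤s z≤n)

pos-factorʳ : ∀ {n m k} → 0 < n → n ≡ m * k → 0 < k
pos-factorʳ {m = m} {k = zero} 0<n n≡ = contradiction (≡.trans n≡ (*-zeroʳ m)) (>⇒≢ 0<n)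
pos-factorʳ {k = suc _} _ _ = s≤s z≤n

pos-factorˡ : ∀ {n m k} → 0 < n → n ≡ m * k → 0 < m
pos-factorˡ {m = m} {k} 0<n n≡ = pos-factorʳ {m = k} 0<n (≡.trans n≡ (*-comm m k))

coprime-∣-* : ∀ {a b o} → Coprime a b → a ∣ o → b ∣ o → a * b ∣ o
coprime-∣-* {a} {b} cop (divides q refl) b∣qa =
  subst (_∣ q * a) (*-comm b a) (*-monoˡ-∣ a b∣q)
  where
  b∣q : b ∣ q
  b∣q = coprime-divisor (Coprime.sym cop) (subst (b ∣_) (*-comm q a) b∣qa)

prime-∣⊎coprime : ∀ {p} n → Prime p → p ∣ n ⊎ Coprime p n
prime-∣⊎coprime {p} n pr with p ∣? n
... | yes p∣n = inj₁ p∣n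
... | no  p∤n = inj₂ common≡1
  where
  common≡1 : Coprime p n
  common≡1 (d∣p , d∣n) with prime⇒irreducible pr d∣p
  ... | inj₁ d≡1 = d≡1
  ... | inj₂ refl = contradiction d∣n p∤n

coprime-pow : ∀ {p n} → Prime p → ¬ p ∣ n → ∀ j → Coprime n (p ^ j)
coprime-pow pr p∤n zero    (_ , d∣1) = ∣1⇒≡1 d∣1
coprime-pow {p} {n} pr p∤n (suc j) (d∣n , d∣p*pʲ) =
  coprime-pow pr p∤n j (d∣n , coprime-divisor d⊥p d∣p*pʲ)
  where
  d⊥p : Coprime _ p
  d⊥p (e∣d , e∣p) with prime-∣⊎coprime n pr
  ... | inj₁ p∣n = contradiction p∣n p∤n
  ... | inj₂ p⊥n = p⊥n (e∣p , ∣-trans e∣d d∣n)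

pow-∣ : ∀ p {j k} → j ≤ k → p ^ j ∣ p ^ k
pow-∣ p {j} {k} j≤k = divides (p ^ (k ∸ j)) (begin
  p ^ k                 ≡⟨ cong (p ^_) (m+[n∸m]≡n j≤k) ⟨
  p ^ (j + (k ∸ j))     ≡⟨ ^-distribˡ-+-* p j (k ∸ j) ⟩
  p ^ j * p ^ (k ∸ j)   ≡⟨ *-comm (p ^ j) _ ⟩
  p ^ (k ∸ j) * p ^ j   ∎)
  where open ≡.≡-Reasoning

primeFactor : ∀ c → 2 ≤ c → ∃ λ p → Prime p × p ∣ c
primeFactor c@(suc _) 2≤c with factorise c
... | record { factors = [] ; isFactorisation = c≡1 } = contradiction (subst (2 ≤_) c≡1 2≤c) λ { (s≤s ()) }
... | record { factors = p ∷ ps ; isFactorisation = c≡ ; factorsPrime = p-prime ∷ _ } =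
  p , p-prime , subst (p ∣_) (≡.sym c≡) (m∣m*n (product ps))

record PPart (p n : ℕ) : Set where
  constructor mkPPart
  field
    j n' : ℕ
    n≡  : n ≡ p ^ j * n'
    p∤n' : ¬ p ∣ n'

-- Split off the p-part of a positive n, by recursion on a bound f for n
-- (each division by p strictly decreases n).
pPart-bounded : ∀ f p n → 2 ≤ p → 0 < n → n ≤ f → PPart p n
pPart-bounded f p n 2≤p 0<n n≤f with p ∣? n
... | no p∤n = mkPPart 0 n (≡.sym (+-identityʳ n)) p∤n
pPart-bounded zero    p n 2≤p 0<n n≤f | yes _ = contradiction (≤-trans 0<n n≤f) λ ()
pPart-bounded (suc f) p n 2≤p 0<n n≤f | yes (divides q n≡qp) =
  mkPPart (suc j) n' (≡.trans n≡qp (≡.trans (cong (_* p) q≡) (rearrange (p ^ j) n'))) p∤n'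
  where
  0<q : 0 < q
  0<q = pos-factorˡ 0<n n≡qp
  q<n : q < n
  q<n = subst (q <_) (≡.sym n≡qp) (m<m*n q p {{>-nonZero 0<q}} 2≤p)
  open PPart (pPart-bounded f p q 2≤p 0<q (≤-pred (≤-trans q<n n≤f))) renaming (n≡ to q≡)
  rearrange : ∀ a b → (a * b) * p ≡ p * a * b
  rearrange a b = ≡.trans (*-comm (a * b) p) (≡.sym (*-assoc p a b))

pPart : ∀ p n → 2 ≤ p → 0 < n → PPart p n
pPart p n 2≤p 0<n = pPart-bounded n p n 2≤p 0<n ≤-refl

-- If a ∤ M (with a, M > 0), some prime p occurs in a to a higher power than in M.
-- This is what makes an element of maximal order have every order as a divisor.
record PrimeExcess (a M : ℕ) : Set where
  field
    p      : ℕ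
    prime  : Prime p
    inA    : PPart p a
    inM    : PPart p M
    excess : PPart.j inM < PPart.j inA

primeExcess : ∀ {a M} → 0 < a → 0 < M → ¬ a ∣ M → PrimeExcess a M
primeExcess {a} {M} 0<a 0<M a∤M = record
  { p = p ; prime = p-prime ; inA = sa ; inM = sM ; excess = ≰⇒> p-power-too-small }
  where
  -- a = c * gcd a M, and c ≠ 1 because a ∤ M; let p be a prime factor of c.
  g = gcd a M
  c = quotient (gcd[m,n]∣m a M)
  a≡cg : a ≡ c * g
  a≡cg = _∣_.equality (gcd[m,n]∣m a M)
  c≢1 : c ≢ 1
  c≢1 c≡1 = a∤M (subst (_∣ M) (≡.sym (≡.trans a≡cg (≡.trans (cong (_* g) c≡1) (*-identityˡ g))))
                   (gcd[m,n]∣n a M))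
  pf = primeFactor c (pos∧≢1⇒≥2 (pos-factorˡ 0<a a≡cg) c≢1)
  p = proj₁ pf
  p-prime = proj₁ (proj₂ pf)
  p∣c = proj₂ (proj₂ pf)
  2≤p : 2 ≤ p
  2≤p = nonTrivial⇒n>1 p {{prime⇒nonTrivial p-prime}}
  sa = pPart p a 2≤p 0<a
  sM = pPart p M 2≤p 0<M
  open PPart sa using (j ; p∤n') renaming (n' to a' ; n≡ to a≡)
  open PPart sM using () renaming (j to k ; n' to M' ; n≡ to M≡)
  instance
    pʲ≢0 : NonZero (p ^ j)
    pʲ≢0 = m^n≢0 p j {{>-nonZero (≤-trans (s≤s z≤n) 2≤p)}}
  -- If j ≤ k then p ^ j divides gcd a M = a / c, so p would divide a' = a / p ^ j.
  p-power-too-small : ¬ j ≤ k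
  p-power-too-small j≤k = p∤n' (subst (p ∣_) (≡.sym a'≡cg') (∣m⇒∣m*n g' p∣c))
    where
    pʲ∣g : p ^ j ∣ g
    pʲ∣g = gcd-greatest (subst (p ^ j ∣_) (≡.sym a≡) (m∣m*n a'))
                        (subst (p ^ j ∣_) (≡.sym M≡) (∣m⇒∣m*n M' (pow-∣ p j≤k)))
    g' = quotient pʲ∣g
    a'≡cg' : a' ≡ c * g'
    a'≡cg' = *-cancelˡ-≡ a' (c * g') (p ^ j) (begin
      p ^ j * a'         ≡⟨ ≡.sym a≡ ⟩
      a                  ≡⟨ a≡cg ⟩
      c * g              ≡⟨ cong (c *_) (_∣_.equality pʲ∣g) ⟩
      c * (g' * p ^ j)   ≡⟨ ≡.sym (*-assoc c g' (p ^ j)) ⟩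
      c * g' * p ^ j     ≡⟨ *-comm (c * g') (p ^ j) ⟩
      p ^ j * (c * g')   ∎)
      where open ≡.≡-Reasoning

r≤ceilDiv*d : ∀ r d → 0 < d → r ≤ ceilDiv r d * d
r≤ceilDiv*d r (suc k) _ = +-cancelʳ-≤ k r (q * d) (begin
  r + k                ≡⟨ m≡m%n+[m/n]*n (r + k) d ⟩
  (r + k) % d + q * d  ≤⟨ +-monoˡ-≤ (q * d) (≤-pred (m%n<n (r + k) d)) ⟩
  k + q * d            ≡⟨ +-comm k (q * d) ⟩
  q * d + k            ∎)
  where
  open ≤-Reasoning
  d = suc k
  q = (r + k) / d

row< : ∀ h s i m r → h * s + i < r → r ≤ m * h → s < m
row< h s i m r lt r≤mh = ≰⇒> λ m≤s → <-irrefl refl (begin-strict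
  m * h       ≡⟨ *-comm m h ⟩
  h * m       ≤⟨ *-monoʳ-≤ h m≤s ⟩
  h * s       ≤⟨ m≤m+n (h * s) i ⟩
  h * s + i   <⟨ <-≤-trans lt r≤mh ⟩
  m * h       ∎)
  where open ≤-Reasoning

shifted-difference< : ∀ s s' m → s < m → s + (m ∸ 1) ∸ s' < 2 * m ∸ 1
shifted-difference< s s' (suc m') s<m = begin-strict
  s + m' ∸ s'      ≤⟨ m∸n≤m (s + m') s' ⟩
  s + m'           <⟨ s≤s (+-monoˡ-≤ m' (≤-pred s<m)) ⟩
  suc (m' + m')    ≡⟨ ≡.trans (cong (λ z → m' + suc z) (+-identityʳ m')) (+-suc m' m') ⟨
  2 * suc m' ∸ 1   ∎
  where open ≤-Reasoning

∣∧<⇒≡0 : ∀ {n k} → n ∣ k → k < n → k ≡ 0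
∣∧<⇒≡0 {k = zero}  _   _   = refl
∣∧<⇒≡0 {k = suc k} n∣k k<n = contradiction (∣⇒≤ n∣k) (<⇒≱ k<n)

remQuot-injective : ∀ {m} n {i j : Fin (m * n)} → remQuot {m} n i ≡ remQuot n j → i ≡ j
remQuot-injective {m} n {i} {j} eq = ≡.trans (≡.sym (FinP.combine-remQuot {m} n i))
  (≡.trans (cong (uncurry combine) eq) (FinP.combine-remQuot {m} n j))

∣-div⇒*∣ : ∀ {N e d} → 0 < e → e ∣ N → d ∣ N div e → d * e ∣ N
∣-div⇒*∣ {e = suc _} _ e∣N d∣N/e = m∣n/o⇒m*o∣n e∣N d∣N/e

argmax : ∀ {n} → Fin n → (f : Fin n → ℕ) → ∃ λ i → ∀ j → f j ≤ f i
argmax {suc zero}    _ f = zero , λ { zero → ≤-refl }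
argmax {suc (suc n)} _ f with argmax zero (λ j → f (suc j))
... | i , f≤fi with f zero ≤? f (suc i)
...   | yes f0≤ = suc i , λ { zero → f0≤ ; (suc j) → f≤fi j }
...   | no  f0≰ = zero , λ { zero → ≤-refl ; (suc j) → ≤-trans (f≤fi j) (<⇒≤ (≰⇒> f0≰)) }

least-witness : ∀ {q} (Q : ℕ → Set q) → (∀ n → Dec (Q n)) → ∀ n → Q n → ∃ λ t → Q t × (∀ s → s < t → ¬ Q s)
least-witness Q Q? n Qn = descend n n ≤-refl Qn
  where
  descend : ∀ f n → n ≤ f → Q n → ∃ λ t → Q t × (∀ s → s < t → ¬ Q s)
  descend f n n≤f Qn with FinP.any? {n = n} (λ i → Q? (toℕ i))
  ... | no none = n , Qn , λ s s<n Qs → none (fromℕ< s<n , subst Q (≡.sym (FinP.toℕ-fromℕ< s<n)) Qs)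
  descend zero    n n≤f Qn | yes (i , Qi) = contradiction (≤-trans (FinP.toℕ<n i) n≤f) λ ()
  descend (suc f) n n≤f Qn | yes (i , Qi) = descend f (toℕ i) (≤-pred (≤-trans (FinP.toℕ<n i) n≤f)) Qi

lcmList-∣ : ∀ {x} l → x ∈ l → x ∣ lcmList l
lcmList-∣ (y ∷ l) (here refl) = m∣lcm[m,n] y (lcmList l)
lcmList-∣ (y ∷ l) (there x∈l) = ∣-trans (lcmList-∣ l x∈l) (n∣lcm[m,n] y (lcmList l))

lcmList-least : ∀ l {M} → (∀ {x} → x ∈ l → x ∣ M) → lcmList l ∣ M
lcmList-least []      {M} _ = 1∣ M
lcmList-least (y ∷ l) all∣M = lcm-least (all∣M (here refl)) (lcmList-least l (λ x∈l → all∣M (there x∈l)))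

lcmFin-attained : ∀ N (o : Fin N → ℕ) i₀ → (∀ i → o i ∣ o i₀) → lcmFin N o ≡ o i₀
lcmFin-attained N o i₀ all∣ = ∣-antisym
  (lcmList-least (map o (allFin N)) λ x∈ → let (i , _ , x≡oi) = ∈-map⁻ o x∈ in subst (_∣ o i₀) (≡.sym x≡oi) (all∣ i))
  (lcmList-∣ (map o (allFin N)) (∈-map⁺ o (∈-allFin i₀)))

Fin-pos : ∀ {n} → Fin n → 0 < n
Fin-pos zero    = s≤s z≤n
Fin-pos (suc _) = s≤s z≤n

regroup-size : ∀ j p P → j * (p * P) ≡ p * j * P
regroup-size = solve-∀

regroup-divisor : ∀ M j p P → M * (j * (p * P)) ≡ P * (M * j * p)
regroup-divisor = solve-∀

coprime-extension-∣ : ∀ {s t p N} → 0 < s → Coprime p t → s * p ∣ N → t * s ∣ N → t * s * p ∣ N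
coprime-extension-∣ {s} {t} {p} {N} 0<s p⊥t sp∣N (divides β N≡) = divides γ (begin
  N                 ≡⟨ N≡ ⟩
  β * (t * s)       ≡⟨ cong (_* (t * s)) β≡ ⟩
  γ * p * (t * s)   ≡⟨ regroup γ p t s ⟩
  γ * (t * s * p)   ∎)
  where
  open ≡.≡-Reasoning
  instance _ = >-nonZero 0<s
  regroup : ∀ γ p t s → γ * p * (t * s) ≡ γ * (t * s * p)
  regroup = solve-∀
  p∣tβ : p ∣ t * β
  p∣tβ = *-cancelʳ-∣ s (subst₂ _∣_ (*-comm s p) (≡.trans N≡ (regroup′ β t s)) sp∣N)
    where
    regroup′ : ∀ β t s → β * (t * s) ≡ t * β * s
    regroup′ = solve-∀
  γ = quotient (coprime-divisor p⊥t p∣tβ)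
  β≡ : β ≡ γ * p
  β≡ = _∣_.equality (coprime-divisor p⊥t p∣tβ)

rotate-product : ∀ a b c → a * (b * c) ≡ b * (c * a)
rotate-product = solve-∀

-- The group-theoretic part, in an abelian group G written additively: g ∙ h ⁻¹ is g - h,
-- and n · g the n-fold multiple of g.
module GroupTheory {c ℓ : Level} (G : AbelianGroup c ℓ) where
  open AbelianGroup G renaming (refl to ≈-refl; sym to ≈-sym; trans to ≈-trans; reflexive to ≈-reflexive)
  open import Algebra.Properties.AbelianGroup G
  open import Algebra.Properties.CommutativeMonoid.Mult commutativeMonoid
    using (×-congʳ; ×-congˡ; ×-homo-+; ×-assocˡ; ×-distrib-+) renaming (_×_ to _·_)
  open import Algebra.Properties.CommutativeSemigroup commutativeSemigroup using (interchange; x∙yz≈xz∙y)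
  open import Relation.Binary.Reasoning.Setoid setoid

  times≈· : ∀ n g → times G n g ≈ n · g
  times≈· zero    g = ≈-refl
  times≈· (suc n) g = ∙-congˡ (times≈· n g)

  ·-ε : ∀ n → n · ε ≈ ε
  ·-ε zero    = ≈-refl
  ·-ε (suc n) = ≈-trans (identityˡ _) (·-ε n)

  ·-⁻¹ : ∀ n g → n · (g ⁻¹) ≈ (n · g) ⁻¹
  ·-⁻¹ n g = inverseʳ-unique (n · g) (n · (g ⁻¹)) (begin
    n · g ∙ n · (g ⁻¹)  ≈⟨ ×-distrib-+ g (g ⁻¹) n ⟨
    n · (g ∙ g ⁻¹)      ≈⟨ ×-congʳ n (inverseʳ g) ⟩
    n · ε               ≈⟨ ·-ε n ⟩
    ε                   ∎)

  ·-swap : ∀ m n g → m · n · g ≈ n · m · g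
  ·-swap m n g = ≈-trans (×-assocˡ g m n) (≈-trans (×-congˡ (*-comm m n)) (≈-sym (×-assocˡ g n m)))

  xy∙y⁻¹≈x : ∀ x y → x ∙ y ∙ y ⁻¹ ≈ x
  xy∙y⁻¹≈x x y = ≈-trans (assoc _ _ _) (≈-trans (∙-congˡ (inverseʳ y)) (identityʳ x))

  difference-of-multiples : ∀ {m n} z → m ≡ 1 + n → m · z ∙ (n · z) ⁻¹ ≈ z
  difference-of-multiples {m} {n} z m≡ = begin
    m · z ∙ (n · z) ⁻¹        ≈⟨ ∙-congʳ (×-congˡ m≡) ⟩
    (z ∙ n · z) ∙ (n · z) ⁻¹  ≈⟨ xy∙y⁻¹≈x z (n · z) ⟩
    z                         ∎

  cross-difference : ∀ {a b c d} → a ∙ d ≈ c ∙ b → a ∙ b ⁻¹ ≈ c ∙ d ⁻¹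
  cross-difference {a} {b} {c} {d} a+d≈c+b = begin
    a ∙ b ⁻¹                    ≈⟨ identityʳ _ ⟨
    a ∙ b ⁻¹ ∙ ε                ≈⟨ ∙-congˡ (inverseʳ d) ⟨
    a ∙ b ⁻¹ ∙ (d ∙ d ⁻¹)       ≈⟨ interchange _ _ _ _ ⟩
    a ∙ d ∙ (b ⁻¹ ∙ d ⁻¹)       ≈⟨ ∙-congʳ a+d≈c+b ⟩
    c ∙ b ∙ (b ⁻¹ ∙ d ⁻¹)       ≈⟨ assoc _ _ _ ⟩
    c ∙ (b ∙ (b ⁻¹ ∙ d ⁻¹))     ≈⟨ ∙-congˡ (assoc _ _ _) ⟨
    c ∙ (b ∙ b ⁻¹ ∙ d ⁻¹)       ≈⟨ ∙-congˡ (∙-congʳ (inverseʳ b)) ⟩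
    c ∙ (ε ∙ d ⁻¹)              ≈⟨ ∙-congˡ (identityˡ _) ⟩
    c ∙ d ⁻¹                    ∎

  inverse-via-multiple : ∀ {u t} y → u ≤ t → (u · y) ⁻¹ ≈ (t ∸ u) · y ∙ (t · y) ⁻¹
  inverse-via-multiple {u} {t} y u≤t = ≈-sym (inverseʳ-unique (u · y) _ (begin
    u · y ∙ ((t ∸ u) · y ∙ (t · y) ⁻¹)   ≈⟨ assoc _ _ _ ⟨
    (u · y ∙ (t ∸ u) · y) ∙ (t · y) ⁻¹   ≈⟨ ∙-congʳ (×-homo-+ y u (t ∸ u)) ⟨
    (u + (t ∸ u)) · y ∙ (t · y) ⁻¹       ≈⟨ ∙-congʳ (×-congˡ (m+[n∸m]≡n u≤t)) ⟩
    t · y ∙ (t · y) ⁻¹                   ≈⟨ inverseʳ _ ⟩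
    ε                                    ∎))

  record IsOrder (g : Carrier) (n : ℕ) : Set ℓ where
    field
      pos   : 0 < n
      kills : n · g ≈ ε
      least : ∀ m → m · g ≈ ε → n ∣ m

  fromElemOrder : ∀ {g n} → IsElemOrder G g n → IsOrder g n
  fromElemOrder {g} {n} (0<n , times-n-g≈ε , minimal) = record { pos = 0<n ; kills = n·g≈ε ; least = least }
    where
    instance _ = >-nonZero 0<n
    n·g≈ε : n · g ≈ ε
    n·g≈ε = ≈-trans (≈-sym (times≈· n g)) times-n-g≈ε
    least : ∀ m → m · g ≈ ε → n ∣ m
    least m m·g≈ε with m % n ≟ 0
    ... | yes m%n≡0 = m%n≡0⇒n∣m m n m%n≡0
    ... | no  m%n≢0 = contradiction (≈-trans (times≈· (m % n) g) remainder-kills)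
                        (minimal (m % n) (n≢0⇒n>0 m%n≢0) (m%n<n m n))
      where
      remainder-kills : (m % n) · g ≈ ε
      remainder-kills = begin
        (m % n) · g                           ≈⟨ identityʳ _ ⟨
        (m % n) · g ∙ ε                       ≈⟨ ∙-congˡ (≈-trans (×-congʳ (m / n) n·g≈ε) (·-ε (m / n))) ⟨
        (m % n) · g ∙ (m / n) · n · g         ≈⟨ ∙-congˡ (×-assocˡ g (m / n) n) ⟩
        (m % n) · g ∙ (m / n * n) · g         ≈⟨ ×-homo-+ g (m % n) (m / n * n) ⟨
        (m % n + m / n * n) · g               ≈⟨ ×-congˡ (m≡m%n+[m/n]*n m n) ⟨
        m · g                                 ≈⟨ m·g≈ε ⟩
        ε                                     ∎

  module _ {g n} (g-order : IsOrder g n) where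
    open IsOrder g-order

    multiple-kills : ∀ {m} → n ∣ m → m · g ≈ ε
    multiple-kills (divides q refl) = ≈-trans (≈-sym (×-assocˡ g q n)) (≈-trans (×-congʳ q kills) (·-ε q))

    ·-injective-below : ∀ {a b} → a ≤ b → a · g ≈ b · g → b < n → a ≡ b
    ·-injective-below {a} {b} a≤b eq b<n = ≡.trans (cong (_+ a) (≡.sym gap≡0)) (m∸n+n≡m a≤b)
      where
      gap·g≈ε : (b ∸ a) · g ≈ ε
      gap·g≈ε = ≈-sym (∙-cancelʳ (a · g) ε _ (begin
        ε ∙ a · g            ≈⟨ identityˡ _ ⟩
        a · g                ≈⟨ eq ⟩
        b · g                ≈⟨ ×-congˡ (m∸n+n≡m a≤b) ⟨
        (b ∸ a + a) · g      ≈⟨ ×-homo-+ g (b ∸ a) a ⟩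
        (b ∸ a) · g ∙ a · g  ∎))
      gap≡0 : b ∸ a ≡ 0
      gap≡0 = ∣∧<⇒≡0 (least _ gap·g≈ε) (≤-<-trans (m∸n≤m b a) b<n)

    multiples-distinct : ∀ {a b} → a · g ≈ b · g → a < n → b < n → a ≡ b
    multiples-distinct {a} {b} eq a<n b<n with ≤-total a b
    ... | inj₁ a≤b = ·-injective-below a≤b eq b<n
    ... | inj₂ b≤a = ≡.sym (·-injective-below b≤a (≈-sym eq) a<n)

  order-unique : ∀ {g a b} → IsOrder g a → IsOrder g b → a ≡ b
  order-unique oa ob = ∣-antisym (IsOrder.least oa _ (IsOrder.kills ob)) (IsOrder.least ob _ (IsOrder.kills oa))

  order-resp : ∀ {g h n} → g ≈ h → IsOrder g n → IsOrder h n
  order-resp {n = n} g≈h og = record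
    { pos   = IsOrder.pos og
    ; kills = ≈-trans (×-congʳ n (≈-sym g≈h)) (IsOrder.kills og)
    ; least = λ m m·h≈ε → IsOrder.least og m (≈-trans (×-congʳ m g≈h) m·h≈ε) }

  order-of-multiple : ∀ {g s q} → 0 < s → IsOrder g (s * q) → IsOrder (s · g) q
  order-of-multiple {g} {s} {q} 0<s og = record { pos = pos-factorʳ {m = s} (IsOrder.pos og) refl ; kills = kills ; least = least }
    where
    instance _ = >-nonZero 0<s
    kills : q · s · g ≈ ε
    kills = ≈-trans (·-swap q s g) (≈-trans (×-assocˡ g s q) (IsOrder.kills og))
    least : ∀ m → m · s · g ≈ ε → q ∣ m
    least m m·s·g≈ε = *-cancelˡ-∣ s (IsOrder.least og (s * m)
                        (≈-trans (≈-sym (×-assocˡ g s m)) (≈-trans (·-swap s m g) m·s·g≈ε)))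

  order-of-sum : ∀ {u v a b} → IsOrder u a → IsOrder v b → Coprime a b → IsOrder (u ∙ v) (a * b)
  order-of-sum {u} {v} {a} {b} ou ov a⊥b = record
    { pos = *-mono-< (IsOrder.pos ou) (IsOrder.pos ov) ; kills = kills ; least = least }
    where
    kills : (a * b) · (u ∙ v) ≈ ε
    kills = begin
      (a * b) · (u ∙ v)              ≈⟨ ×-distrib-+ u v (a * b) ⟩
      (a * b) · u ∙ (a * b) · v      ≈⟨ ∙-cong (multiple-kills ou (m∣m*n b)) (multiple-kills ov (n∣m*n a)) ⟩
      ε ∙ ε                          ≈⟨ identityˡ ε ⟩
      ε                              ∎
    -- If m · u + m · v = ε then b m · u = - b m · v = ε, so a ∣ b m, hence a ∣ m.
    order-divides : ∀ {u v a b} → IsOrder u a → IsOrder v b → Coprime a b → ∀ m → m · u ∙ m · v ≈ ε → a ∣ m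
    order-divides {u} {v} {a} {b} ou ov a⊥b m sum≈ε = coprime-divisor a⊥b (IsOrder.least ou (b * m) (begin
      (b * m) · u          ≈⟨ ×-assocˡ u b m ⟨
      b · m · u            ≈⟨ ×-congʳ b (inverseˡ-unique _ _ sum≈ε) ⟩
      b · ((m · v) ⁻¹)     ≈⟨ ·-⁻¹ b (m · v) ⟩
      (b · m · v) ⁻¹       ≈⟨ ⁻¹-cong (≈-trans (×-assocˡ v b m) (multiple-kills ov (m∣m*n m))) ⟩
      ε ⁻¹                 ≈⟨ ε⁻¹≈ε ⟩
      ε                    ∎))
    least : ∀ m → m · (u ∙ v) ≈ ε → a * b ∣ m
    least m m·uv≈ε = coprime-∣-* a⊥b (order-divides ou ov a⊥b m split≈ε)
                       (order-divides ov ou (Coprime.sym a⊥b) m (≈-trans (comm _ _) split≈ε))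
      where split≈ε = ≈-trans (≈-sym (×-distrib-+ u v m)) m·uv≈ε

  -- If ord y does not divide ord x, some element has order larger than ord x:
  -- with a = pʲ a', M = pᵏ M' (k < j, p ∤ M'), take pᵏ · x + a' · y of order M' pʲ.
  larger-order : ∀ {x y M a} → IsOrder x M → IsOrder y a → ¬ a ∣ M → ∃ λ w → ∃ λ n → IsOrder w n × M < n
  larger-order {x} {y} {M} {a} ox oy a∤M =
    u ∙ v , M' * p ^ j , order-of-sum ou ov (coprime-pow prime p∤M' j) , M<M'pʲ
    where
    open PrimeExcess (primeExcess (IsOrder.pos oy) (IsOrder.pos ox) a∤M)
    open PPart inA renaming (n' to a' ; n≡ to a≡)
    open PPart inM using () renaming (j to k ; n' to M' ; n≡ to M≡ ; p∤n' to p∤M')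
    1<p = nonTrivial⇒n>1 p {{prime⇒nonTrivial prime}}
    instance _ = >-nonZero (≤-trans (s≤s z≤n) 1<p)
    u = (p ^ k) · x
    v = a' · y
    ou : IsOrder u M'
    ou = order-of-multiple {s = p ^ k} (m^n>0 p k) (subst (IsOrder x) M≡ ox)
    ov : IsOrder v (p ^ j)
    ov = order-of-multiple {s = a'} (pos-factorʳ {m = p ^ j} (IsOrder.pos oy) a≡)
                           (subst (IsOrder y) (≡.trans a≡ (*-comm (p ^ j) a')) oy)
    M<M'pʲ : M < M' * p ^ j
    M<M'pʲ = subst (_< M' * p ^ j) (≡.trans (*-comm M' (p ^ k)) (≡.sym M≡))
               (*-monoʳ-< M' {{>-nonZero (pos-factorʳ {m = p ^ k} (IsOrder.pos ox) M≡)}} (^-monoʳ-< p 1<p excess))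

  infix 4 _∈ₗ_ _∈ₛ_

  _∈ₗ_ : ∀ {m} → Carrier → (Fin m → Carrier) → Set ℓ
  g ∈ₗ L = ∃ λ k → g ≈ L k

  ∈ₗ-resp : ∀ {m} {L : Fin m → Carrier} {g h} → g ≈ h → g ∈ₗ L → h ∈ₗ L
  ∈ₗ-resp g≈h (k , g≈Lk) = k , ≈-trans (≈-sym g≈h) g≈Lk

  record Subgroup : Set (c ⊔ˡ ℓ) where
    field
      size       : ℕ
      el         : Fin size → Carrier
      injective  : ∀ i j → el i ≈ el j → i ≡ j
      ε∈         : ε ∈ₗ el
      sub-closed : ∀ i j → (el i ∙ el j ⁻¹) ∈ₗ el

  _∈ₛ_ : Carrier → Subgroup → Set ℓ
  g ∈ₛ S = g ∈ₗ Subgroup.el S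

  module SubgroupProperties (S : Subgroup) where
    open Subgroup S

    size-pos : 0 < size
    size-pos = Fin-pos (proj₁ ε∈)

    ∈-resp : ∀ {g h} → g ≈ h → g ∈ₛ S → h ∈ₛ S
    ∈-resp = ∈ₗ-resp

    -∈ : ∀ {g h} → g ∈ₛ S → h ∈ₛ S → (g ∙ h ⁻¹) ∈ₛ S
    -∈ (i , g≈) (j , h≈) = ∈-resp (≈-sym (∙-cong g≈ (⁻¹-cong h≈))) (sub-closed i j)

    ⁻¹∈ : ∀ {g} → g ∈ₛ S → (g ⁻¹) ∈ₛ S
    ⁻¹∈ g∈ = ∈-resp (identityˡ _) (-∈ ε∈ g∈)

    ∙∈ : ∀ {g h} → g ∈ₛ S → h ∈ₛ S → (g ∙ h) ∈ₛ S
    ∙∈ g∈ h∈ = ∈-resp (∙-congˡ (⁻¹-involutive _)) (-∈ g∈ (⁻¹∈ h∈))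

    ·∈ : ∀ n {g} → g ∈ₛ S → n · g ∈ₛ S
    ·∈ zero    g∈ = ε∈
    ·∈ (suc n) g∈ = ∙∈ g∈ (·∈ n g∈)

    ·∈-scaled : ∀ x a {z} → a · z ∈ₛ S → (x * a) · z ∈ₛ S
    ·∈-scaled x a {z} a·z∈ = ∈-resp (×-assocˡ z x a) (·∈ x a·z∈)

    -- If a · z and b · z lie in S for coprime a, b, then so does z (Bézout).
    coprime-multiples⇒∈ : ∀ {a b z} → Coprime a b → a · z ∈ₛ S → b · z ∈ₛ S → z ∈ₛ S
    coprime-multiples⇒∈ {a} {b} {z} a⊥b a·z∈ b·z∈ with coprime-Bézout a⊥b
    ... | Bézout.+- x y eq =
      ∈-resp (difference-of-multiples z (≡.sym eq)) (-∈ (·∈-scaled x a a·z∈) (·∈-scaled y b b·z∈))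
    ... | Bézout.-+ x y eq =
      ∈-resp (difference-of-multiples z (≡.sym eq)) (-∈ (·∈-scaled y b b·z∈) (·∈-scaled x a a·z∈))

  record OrderModulo (S : Subgroup) (y : Carrier) (t : ℕ) : Set ℓ where
    field
      pos     : 0 < t
      in-S    : t · y ∈ₛ S
      minimal : ∀ s → 0 < s → s < t → ¬ (s · y ∈ₛ S)

  -- The subgroup S + ⟨y⟩, listed without repetition as el i + s · y (s < t).
  module Adjoin (S : Subgroup) (y : Carrier) (t : ℕ) (y-mod : OrderModulo S y t) where
    open Subgroup S
    open SubgroupProperties S
    open OrderModulo y-mod
    instance _ = >-nonZero pos

    -- Position k of the listing stands for the pair (coefficient of y, index in S).
    position : Fin (t * size) → Fin t × Fin size
    position = remQuot {t} size

    coeff : Fin (t * size) → ℕ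
    coeff k = toℕ (proj₁ (position k))

    base : Fin (t * size) → Fin size
    base k = proj₂ (position k)

    el⁺ : Fin (t * size) → Carrier
    el⁺ k = el (base k) ∙ coeff k · y

    el⁺-combine : ∀ s i → el i ∙ toℕ s · y ≈ el⁺ (combine s i)
    el⁺-combine s i = ≈-reflexive (cong (λ p → el (proj₂ p) ∙ toℕ (proj₁ p) · y)
                                        (≡.sym (FinP.remQuot-combine {t} {size} s i)))

    -- Every h + u · y with h ∈ S is listed: reduce u modulo t, moving (u / t) t · y into S.
    ∈⁺ : ∀ {h} u → h ∈ₛ S → h ∙ u · y ∈ₗ el⁺
    ∈⁺ {h} u h∈ = combine s i , (begin
      h ∙ u · y                            ≈⟨ ∙-congˡ (×-congˡ (m≡m%n+[m/n]*n u t)) ⟩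
      h ∙ (u % t + u / t * t) · y          ≈⟨ ∙-congˡ (×-homo-+ y (u % t) (u / t * t)) ⟩
      h ∙ ((u % t) · y ∙ (u / t * t) · y)  ≈⟨ x∙yz≈xz∙y _ _ _ ⟩
      (h ∙ (u / t * t) · y) ∙ (u % t) · y  ≈⟨ ∙-cong (proj₂ h'∈) (×-congˡ (≡.sym (FinP.toℕ-fromℕ< (m%n<n u t)))) ⟩
      el i ∙ toℕ s · y                     ≈⟨ el⁺-combine s i ⟩
      el⁺ (combine s i)                    ∎)
      where
      h'∈ : h ∙ (u / t * t) · y ∈ₛ S
      h'∈ = ∙∈ h∈ (·∈-scaled (u / t) t in-S)
      i = proj₁ h'∈
      s = fromℕ< (m%n<n u t)

    -- Closed under subtraction: -s' · y = (t - s') · y - t · y with t · y ∈ S.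
    sub-closed⁺ : ∀ j k → (el⁺ j ∙ el⁺ k ⁻¹) ∈ₗ el⁺
    sub-closed⁺ j k = ∈ₗ-resp (≈-sym rearranged) (∈⁺ (s + (t ∸ s')) h∈)
      where
      i = base j ; s = coeff j ; i' = base k ; s' = coeff k
      s'≤t = <⇒≤ (FinP.toℕ<n (proj₁ (position k)))
      h∈ : el i ∙ el i' ⁻¹ ∙ (t · y) ⁻¹ ∈ₛ S
      h∈ = -∈ (sub-closed i i') in-S
      rearranged : (el i ∙ s · y) ∙ (el i' ∙ s' · y) ⁻¹ ≈ el i ∙ el i' ⁻¹ ∙ (t · y) ⁻¹ ∙ (s + (t ∸ s')) · y
      rearranged = begin
        (el i ∙ s · y) ∙ (el i' ∙ s' · y) ⁻¹                          ≈⟨ ∙-congˡ (⁻¹-∙-comm _ _) ⟨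
        (el i ∙ s · y) ∙ (el i' ⁻¹ ∙ (s' · y) ⁻¹)                     ≈⟨ interchange _ _ _ _ ⟩
        (el i ∙ el i' ⁻¹) ∙ (s · y ∙ (s' · y) ⁻¹)                     ≈⟨ ∙-congˡ (∙-congˡ (inverse-via-multiple y s'≤t)) ⟩
        (el i ∙ el i' ⁻¹) ∙ (s · y ∙ ((t ∸ s') · y ∙ (t · y) ⁻¹))     ≈⟨ ∙-congˡ (assoc _ _ _) ⟨
        (el i ∙ el i' ⁻¹) ∙ ((s · y ∙ (t ∸ s') · y) ∙ (t · y) ⁻¹)     ≈⟨ x∙yz≈xz∙y _ _ _ ⟩
        (el i ∙ el i' ⁻¹ ∙ (t · y) ⁻¹) ∙ (s · y ∙ (t ∸ s') · y)       ≈⟨ ∙-congˡ (×-homo-+ y s (t ∸ s')) ⟨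
        el i ∙ el i' ⁻¹ ∙ (t · y) ⁻¹ ∙ (s + (t ∸ s')) · y             ∎

    -- el i + a · y = el i' + b · y with a ≤ b < t forces a = b and i = i':
    -- (b - a) · y = el i - el i' lies in S, so b - a = 0 by minimality of t.
    same-coefficients : ∀ {i i' a b} → a ≤ b → b < t → el i ∙ a · y ≈ el i' ∙ b · y → a ≡ b × i ≡ i'
    same-coefficients {i} {i'} {a} {b} a≤b b<t eq = a≡b , injective i i' el-i≈el-i'
      where
      δ = b ∸ a
      el-i≈ : el i ≈ el i' ∙ δ · y
      el-i≈ = ∙-cancelʳ (a · y) _ _ (begin
        el i ∙ a · y              ≈⟨ eq ⟩
        el i' ∙ b · y             ≈⟨ ∙-congˡ (×-congˡ (m∸n+n≡m a≤b)) ⟨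
        el i' ∙ (δ + a) · y       ≈⟨ ∙-congˡ (×-homo-+ y δ a) ⟩
        el i' ∙ (δ · y ∙ a · y)   ≈⟨ assoc _ _ _ ⟨
        el i' ∙ δ · y ∙ a · y     ∎)
      δ·y∈ : δ · y ∈ₛ S
      δ·y∈ = ∈-resp (≈-trans (∙-congʳ el-i≈) (xyx⁻¹≈y _ _)) (sub-closed i i')
      δ≡0 : ∀ d → d ≤ b → d · y ∈ₛ S → d ≡ 0
      δ≡0 zero    _   _  = refl
      δ≡0 (suc d) d≤b d∈ = contradiction d∈ (minimal (suc d) (s≤s z≤n) (≤-<-trans d≤b b<t))
      gap = δ≡0 δ (m∸n≤m b a) δ·y∈
      a≡b : a ≡ b
      a≡b = ≡.trans (cong (_+ a) (≡.sym gap)) (m∸n+n≡m a≤b)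
      el-i≈el-i' : el i ≈ el i'
      el-i≈el-i' = ≈-trans el-i≈ (≈-trans (∙-congˡ (×-congˡ gap)) (identityʳ _))

    injective⁺ : ∀ j k → el⁺ j ≈ el⁺ k → j ≡ k
    injective⁺ j k eq = remQuot-injective {t} size (cong₂ _,_ (FinP.toℕ-injective same-coeff) same-base)
      where
      coefficients-and-bases : coeff j ≡ coeff k × base j ≡ base k
      coefficients-and-bases with ≤-total (coeff j) (coeff k)
      ... | inj₁ j≤k = same-coefficients j≤k (FinP.toℕ<n (proj₁ (position k))) eq
      ... | inj₂ k≤j = let (a≡b , i≡i') = same-coefficients k≤j (FinP.toℕ<n (proj₁ (position j))) (≈-sym eq)
                     in ≡.sym a≡b , ≡.sym i≡i'
      same-coeff = proj₁ coefficients-and-bases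
      same-base = proj₂ coefficients-and-bases

    adjoined : Subgroup
    adjoined = record
      { size = t * size ; el = el⁺ ; injective = injective⁺ ; sub-closed = sub-closed⁺
      ; ε∈ = ∈ₗ-resp (identityʳ ε) (∈⁺ 0 ε∈) }

    ⊆adjoined : ∀ {h} → h ∈ₛ S → h ∈ₛ adjoined
    ⊆adjoined h∈ = ∈ₗ-resp (identityʳ _) (∈⁺ 0 h∈)

    y∈adjoined : y ∈ₛ adjoined
    y∈adjoined = ∈ₗ-resp (≈-trans (identityˡ _) (identityʳ y)) (∈⁺ 1 ε∈)

    t·∈S : ∀ {g} → g ∈ₛ adjoined → t · g ∈ₛ S
    t·∈S {g} (k , g≈) = ∈-resp (≈-sym t·g≈) (∙∈ (·∈ t (base k , ≈-refl)) (·∈ (coeff k) in-S))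
      where
      t·g≈ : t · g ≈ t · el (base k) ∙ coeff k · t · y
      t·g≈ = ≈-trans (×-congʳ t g≈) (≈-trans (×-distrib-+ _ _ t) (∙-congˡ (·-swap t (coeff k) y)))

  trivial : Subgroup
  trivial = record
    { size = 1 ; el = λ _ → ε ; injective = λ { zero zero _ → refl } ; ε∈ = zero , ≈-refl
    ; sub-closed = λ _ _ → zero , ≈-trans (∙-congˡ ε⁻¹≈ε) (identityʳ ε) }

  Disjoint : Subgroup → Carrier → Set (c ⊔ˡ ℓ)
  Disjoint K x = ∀ {g} → g ∈ₛ K → ∀ n → g ≈ n · x → g ≈ ε

  disjoint⇒orderModulo : ∀ {K x M} → IsOrder x M → Disjoint K x → OrderModulo K x M
  disjoint⇒orderModulo {K} {x} {M} ox K∩⟨x⟩ = record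
    { pos = IsOrder.pos ox
    ; in-S = SubgroupProperties.∈-resp K (≈-sym (IsOrder.kills ox)) (Subgroup.ε∈ K)
    ; minimal = λ s 0<s s<M s·x∈ →
        >⇒≢ 0<s (∣∧<⇒≡0 (IsOrder.least ox s (K∩⟨x⟩ s·x∈ s ≈-refl)) s<M) }

  trivial-disjoint : ∀ x → Disjoint trivial x
  trivial-disjoint x (_ , g≈ε) _ _ = g≈ε

  disjoint-multiple : ∀ {K x} μ → Disjoint K x → Disjoint K (μ · x)
  disjoint-multiple {x = x} μ K∩⟨x⟩ g∈ n g≈ = K∩⟨x⟩ g∈ (n * μ) (≈-trans g≈ (×-assocˡ x n μ))

  -- If K ∩ ⟨x⟩ = 0 and x has order μ d, then x has order μ modulo H = K + ⟨μ x⟩: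
  -- were s x = k + u μ x with 0 < s < μ and u < d, then k ∈ K ∩ ⟨x⟩ is ε,
  -- so s = u μ by distinctness of the multiples of x below μ d, which is impossible.
  module Stacked (K : Subgroup) (x : Carrier) (μ d : ℕ) (0<μ : 0 < μ) (0<d : 0 < d)
                 (ox : IsOrder x (μ * d)) (K∩⟨x⟩ : Disjoint K x) where
    open Subgroup K
    μx-mod : OrderModulo K (μ · x) d
    μx-mod = disjoint⇒orderModulo (order-of-multiple {g = x} {s = μ} 0<μ ox) (disjoint-multiple {K} {x} μ K∩⟨x⟩)
    open Adjoin K (μ · x) d μx-mod

    H : Subgroup
    H = adjoined

    x-mod : OrderModulo H x μ
    x-mod = record { pos = 0<μ ; in-S = y∈adjoined ; minimal = minimal }
      where
      minimal : ∀ s → 0 < s → s < μ → ¬ (s · x ∈ₛ H)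
      minimal s 0<s s<μ (k , s·x≈) = not-a-multiple u s≡uμ
        where
        i = base k
        u = coeff k
        instance _ = >-nonZero 0<μ
        uμ<μd : u * μ < μ * d
        uμ<μd = subst (u * μ <_) (*-comm d μ) (*-monoˡ-< μ (FinP.toℕ<n (proj₁ (position k))))
        μd·x⁻¹≈ε : ((μ * d) · x) ⁻¹ ≈ ε
        μd·x⁻¹≈ε = ≈-trans (⁻¹-cong (IsOrder.kills ox)) ε⁻¹≈ε
        el-i≈ : el i ≈ (s + (μ * d ∸ u * μ)) · x
        el-i≈ = begin
          el i                                                ≈⟨ xy∙y⁻¹≈x (el i) (u · μ · x) ⟨
          el i ∙ u · μ · x ∙ (u · μ · x) ⁻¹                   ≈⟨ ∙-cong (≈-sym s·x≈) (⁻¹-cong (×-assocˡ x u μ)) ⟩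
          s · x ∙ ((u * μ) · x) ⁻¹                            ≈⟨ ∙-congˡ (inverse-via-multiple x (<⇒≤ uμ<μd)) ⟩
          s · x ∙ ((μ * d ∸ u * μ) · x ∙ ((μ * d) · x) ⁻¹)    ≈⟨ ∙-congˡ (∙-congˡ μd·x⁻¹≈ε) ⟩
          s · x ∙ ((μ * d ∸ u * μ) · x ∙ ε)                   ≈⟨ ∙-congˡ (identityʳ _) ⟩
          s · x ∙ (μ * d ∸ u * μ) · x                         ≈⟨ ×-homo-+ x s _ ⟨
          (s + (μ * d ∸ u * μ)) · x                           ∎
        s·x≈uμ·x : s · x ≈ (u * μ) · x
        s·x≈uμ·x = begin
          s · x              ≈⟨ s·x≈ ⟩
          el i ∙ u · μ · x   ≈⟨ ∙-cong (K∩⟨x⟩ (i , ≈-refl) (s + (μ * d ∸ u * μ)) el-i≈) (×-assocˡ x u μ) ⟩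
          ε ∙ (u * μ) · x    ≈⟨ identityˡ _ ⟩
          (u * μ) · x        ∎
        s≡uμ : s ≡ u * μ
        s≡uμ = multiples-distinct ox s·x≈uμ·x (<-≤-trans s<μ (m≤m*n μ d {{>-nonZero 0<d}})) uμ<μd
        not-a-multiple : ∀ u → s ≢ u * μ
        not-a-multiple zero     s≡0   = >⇒≢ 0<s s≡0
        not-a-multiple (suc u') s≡    = <⇒≱ s<μ (subst (μ ≤_) (≡.sym s≡) (m≤m+n μ (u' * μ)))

  -- The listing of H + ⟨x⟩ begins with the rows H, H + x, H + 2x, …; its first r elements
  -- form a set A ⊆ H + {0, …, m - 1} x with m = ⌈r / h⌉, so
  -- A - A ⊆ H + {-(m - 1), …, m - 1} x has at most h (2m - 1) elements.
  module Progression (H : Subgroup) (x : Carrier) (μ : ℕ) (x-mod : OrderModulo H x μ)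
                     (r : ℕ) (r≤μh : r ≤ μ * Subgroup.size H) where
    open Subgroup H renaming (size to h)
    open Adjoin H x μ x-mod

    m = ceilDiv r h
    width = 2 * m ∸ 1

    A : Fin r → Carrier
    A a = el⁺ (inject≤ a r≤μh)

    A-injective : IsSubsetOfSize G r A
    A-injective a b eq = FinP.inject≤-injective r≤μh r≤μh a b (injective⁺ _ _ eq)

    -- Element a of A sits in row coeff (a) < m, since its position h · coeff + base is below r ≤ m h.
    row-of : Fin r → ℕ
    row-of a = coeff (inject≤ a r≤μh)

    row-of< : ∀ a → row-of a < m
    row-of< a = row< h (row-of a) (toℕ (base k)) m r position< (r≤ceilDiv*d r h (SubgroupProperties.size-pos H))
      where
      k = inject≤ a r≤μh
      position< : h * row-of a + toℕ (base k) < r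
      position< = subst (_< r) (≡.trans (≡.sym (FinP.toℕ-inject≤ a r≤μh))
                    (≡.trans (cong toℕ (≡.sym (FinP.combine-remQuot {μ} h k)))
                             (FinP.toℕ-combine (proj₁ (position k)) (base k))))
                    (FinP.toℕ<n a)

    -- The candidate differences el j + (τ - (m - 1)) x with j < h, τ < 2m - 1.
    difference : Fin (h * width) → Carrier
    difference k = el (proj₁ (remQuot {h} width k)) ∙ (toℕ (proj₂ (remQuot {h} width k)) · x ∙ ((m ∸ 1) · x) ⁻¹)

    difference-combine : ∀ j τ → el j ∙ (toℕ τ · x ∙ ((m ∸ 1) · x) ⁻¹) ≈ difference (combine j τ)
    difference-combine j τ = ≈-reflexive (cong (λ p → el (proj₁ p) ∙ (toℕ (proj₂ p) · x ∙ ((m ∸ 1) · x) ⁻¹))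
                                                (≡.sym (FinP.remQuot-combine {h} {width} j τ)))

    shifted : ∀ s s' → s' < m → s · x ∙ (s' · x) ⁻¹ ≈ (s + (m ∸ 1) ∸ s') · x ∙ ((m ∸ 1) · x) ⁻¹
    shifted s s' s'<m = cross-difference (begin
      s · x ∙ (m ∸ 1) · x              ≈⟨ ×-homo-+ x s (m ∸ 1) ⟨
      (s + (m ∸ 1)) · x                ≈⟨ ×-congˡ (m∸n+n≡m s'≤) ⟨
      (s + (m ∸ 1) ∸ s' + s') · x      ≈⟨ ×-homo-+ x (s + (m ∸ 1) ∸ s') s' ⟩
      (s + (m ∸ 1) ∸ s') · x ∙ s' · x  ∎)
      where
      s'≤ : s' ≤ s + (m ∸ 1)
      s'≤ = ≤-trans (∸-monoˡ-≤ 1 s'<m) (m≤n+m (m ∸ 1) s)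

    covered : ∀ a b → ∃ λ k → sub G (A a) (A b) ≈ difference k
    covered a b = combine j τ , (begin
      (el i ∙ s · x) ∙ (el i' ∙ s' · x) ⁻¹                ≈⟨ ∙-congˡ (⁻¹-∙-comm _ _) ⟨
      (el i ∙ s · x) ∙ (el i' ⁻¹ ∙ (s' · x) ⁻¹)           ≈⟨ interchange _ _ _ _ ⟩
      (el i ∙ el i' ⁻¹) ∙ (s · x ∙ (s' · x) ⁻¹)           ≈⟨ ∙-cong (proj₂ j∈) (shifted s s' (row-of< b)) ⟩
      el j ∙ (toℕ-τ · x ∙ ((m ∸ 1) · x) ⁻¹)               ≈⟨ ∙-congˡ (∙-congʳ (×-congˡ (FinP.toℕ-fromℕ< τ<))) ⟨
      el j ∙ (toℕ τ · x ∙ ((m ∸ 1) · x) ⁻¹)               ≈⟨ difference-combine j τ ⟩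
      difference (combine j τ)                            ∎)
      where
      i = base (inject≤ a r≤μh) ; s = row-of a
      i' = base (inject≤ b r≤μh) ; s' = row-of b
      j∈ = sub-closed i i'
      j = proj₁ j∈
      toℕ-τ = s + (m ∸ 1) ∸ s'
      τ< : toℕ-τ < width
      τ< = shifted-difference< s s' m (row-of< a)
      τ = fromℕ< τ<

    progression-set : RhoMinusAtMost G r (h * width)
    progression-set = A , A-injective , difference , covered

  module Finite (N : ℕ) (fin : HasOrder G N) (o : Fin N → ℕ)
                (ho : ∀ i → IsElemOrder G (HasOrder.enum fin i) (o i)) where
    open HasOrder fin

    _≈?_ : ∀ g h → Dec (g ≈ h)
    g ≈? h with enum-surj g | enum-surj h
    ... | i , g≈ | j , h≈ with i FinP.≟ j
    ...   | yes refl = yes (≈-trans g≈ (≈-sym h≈))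
    ...   | no  i≢j  = no λ g≈h → i≢j (enum-inj i j (≈-trans (≈-sym g≈) (≈-trans g≈h h≈)))

    infix 4 _∈ₗ?_

    _∈ₗ?_ : ∀ {m} g (L : Fin m → Carrier) → Dec (g ∈ₗ L)
    g ∈ₗ? L = FinP.any? (λ k → g ≈? L k)

    index : Carrier → Fin N
    index g = proj₁ (enum-surj g)

    N-pos : 0 < N
    N-pos = Fin-pos (index ε)

    orderOf-isOrder : ∀ g → IsOrder g (o (index g))
    orderOf-isOrder g = order-resp (≈-sym (proj₂ (enum-surj g))) (fromElemOrder (ho (index g)))

    injective⇒≤N : ∀ {m} (L : Fin m → Carrier) → (∀ i j → L i ≈ L j → i ≡ j) → m ≤ N
    injective⇒≤N L inj = FinP.injective⇒≤ {f = λ i → index (L i)} λ {i} {j} eq →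
      inj i j (≈-trans (proj₂ (enum-surj (L i))) (≈-trans (≈-reflexive (cong enum eq)) (≈-sym (proj₂ (enum-surj (L j))))))

    covering⇒N≤ : ∀ {m} (L : Fin m → Carrier) → (∀ a → enum a ∈ₗ L) → N ≤ m
    covering⇒N≤ L cov = FinP.injective⇒≤ {f = λ a → proj₁ (cov a)} λ {a} {b} eq →
      enum-inj a b (≈-trans (proj₂ (cov a)) (≈-trans (≈-reflexive (cong L eq)) (≈-sym (proj₂ (cov b)))))

    missed : ∀ {m} (L : Fin m → Carrier) → ¬ (∀ a → enum a ∈ₗ L) → ∃ λ g → ¬ g ∈ₗ L
    missed L ¬cov = let (a , a∉) = FinP.¬∀⟶∃¬ N _ (λ a → enum a ∈ₗ? L) ¬cov in enum a , a∉

    record Exponent : Set (c ⊔ˡ ℓ) where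
      field
        x       : Carrier
        M       : ℕ
        x-order : IsOrder x M
        M-kills : ∀ y → M · y ≈ ε
        M≡lcm   : lcmFin N o ≡ M

    -- An element of maximal order will do: if some order did not divide its order M,
    -- larger-order would produce an element of order exceeding M.
    exponent : Exponent
    exponent = record
      { x = enum i₀ ; M = o i₀ ; x-order = ox
      ; M-kills = λ y → multiple-kills (orderOf-isOrder y) (divides-max (index y))
      ; M≡lcm = lcmFin-attained N o i₀ divides-max }
      where
      i₀ = proj₁ (argmax (index ε) o)
      maximal = proj₂ (argmax (index ε) o)
      ox = fromElemOrder (ho i₀)
      nothing-larger : ¬ ∃ λ w → ∃ λ n → IsOrder w n × o i₀ < n
      nothing-larger (w , n , ow , o₀<n) =
        <⇒≱ (subst (o i₀ <_) (order-unique ow (orderOf-isOrder w)) o₀<n) (maximal (index w))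
      divides-max : ∀ i → o i ∣ o i₀
      divides-max i with o i ∣? o i₀
      ... | yes oi∣ = oi∣
      ... | no  oi∤ = contradiction (larger-order ox (fromElemOrder (ho i)) oi∤) nothing-larger

    -- Collect representatives of distinct
    -- cosets R r + S; their union has n |S| distinct elements, and either covers G or misses
    -- an element that represents a new coset.
    module Cosets (S : Subgroup) where
      open Subgroup S
      open SubgroupProperties S

      Inequivalent : ∀ {n} → (Fin n → Carrier) → Set ℓ
      Inequivalent R = ∀ r r' → R r ∙ R r' ⁻¹ ∈ₛ S → r ≡ r'

      union : ∀ {n} → (Fin n → Carrier) → Fin (n * size) → Carrier
      union {n} R k = R (proj₁ (remQuot {n} size k)) ∙ el (proj₂ (remQuot {n} size k))

      union-injective : ∀ {n} (R : Fin n → Carrier) → Inequivalent R → ∀ k k' → union R k ≈ union R k' → k ≡ k'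
      union-injective {n} R R-ineq k k' eq = remQuot-injective {n} size (cong₂ _,_ r≡r' (injective i i' el-i≈el-i'))
        where
        r = proj₁ (remQuot {n} size k) ; i = proj₂ (remQuot {n} size k)
        r' = proj₁ (remQuot {n} size k') ; i' = proj₂ (remQuot {n} size k')
        r≡r' : r ≡ r'
        r≡r' = R-ineq r r' (∈-resp (≈-sym (cross-difference (≈-trans eq (comm _ _)))) (sub-closed i' i))
        el-i≈el-i' : el i ≈ el i'
        el-i≈el-i' = ∙-cancelˡ (R r) _ _ (≈-trans eq (∙-congʳ (≈-reflexive (cong R (≡.sym r≡r')))))

      coset∈ : ∀ {n} (R : Fin n → Carrier) r {h} → h ∈ₛ S → R r ∙ h ∈ₗ union R
      coset∈ {n} R r (i , h≈) = combine r i , ≈-trans (∙-congˡ h≈)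
        (≈-reflexive (cong (λ p → R (proj₁ p) ∙ el (proj₂ p)) (≡.sym (FinP.remQuot-combine {n} {size} r i))))

      -- k bounds the room left: N ≤ n |S| + k.
      fill : ∀ k n (R : Fin n → Carrier) → Inequivalent R → N ≤ n * size + k → size ∣ N
      fill zero n R R-ineq room = divides n (≤-antisym (subst (N ≤_) (+-identityʳ _) room)
                                                      (injective⇒≤N (union R) (union-injective R R-ineq)))
      fill (suc k) n R R-ineq room with FinP.all? (λ a → enum a ∈ₗ? union R)
      ... | yes cov = divides n (≤-antisym (covering⇒N≤ (union R) cov) (injective⇒≤N (union R) (union-injective R R-ineq)))
      ... | no ¬cov = fill k (suc n) R' R'-ineq room'
        where
        y = proj₁ (missed (union R) ¬cov)
        y∉ = proj₂ (missed (union R) ¬cov)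
        R' : Fin (suc n) → Carrier
        R' zero    = y
        R' (suc r) = R r
        new : ∀ r → ¬ y ∙ R r ⁻¹ ∈ₛ S
        new r y-Rr∈ = y∉ (∈ₗ-resp (≈-trans (≈-sym (assoc _ _ _)) (xyx⁻¹≈y _ _)) (coset∈ R r y-Rr∈))
        R'-ineq : Inequivalent R'
        R'-ineq zero    zero     _  = refl
        R'-ineq zero    (suc r') m  = contradiction m (new r')
        R'-ineq (suc r) zero     m  = contradiction (∈-resp (⁻¹-anti-homo‿- _ _) (⁻¹∈ m)) (new r)
        R'-ineq (suc r) (suc r') m  = cong suc (R-ineq r r' m)
        room' : N ≤ suc n * size + k
        room' = ≤-trans room (≤-trans (≤-reflexive (+-suc (n * size) k))
                  (+-monoˡ-≤ k (+-monoˡ-≤ (n * size) size-pos)))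

    lagrange : ∀ S → Subgroup.size S ∣ N
    lagrange S = Cosets.fill S N 0 (λ ()) (λ ()) ≤-refl

    -- Every y has an order modulo S: some positive multiple of y, e.g. ord(y) · y = ε, lies in S.
    orderModulo : ∀ S y → ∃ (OrderModulo S y)
    orderModulo S y = t , record { pos = proj₁ Qt ; in-S = proj₂ Qt ; minimal = λ s 0<s s<t s·y∈ → below s s<t (0<s , s·y∈) }
      where
      open Subgroup S
      Q : ℕ → Set ℓ
      Q s = 0 < s × s · y ∈ₛ S
      oy = orderOf-isOrder y
      least = least-witness Q (λ s → (0 <? s) ×-dec (s · y ∈ₗ? el)) (o (index y))
                (IsOrder.pos oy , ∈ₗ-resp (≈-sym (IsOrder.kills oy)) ε∈)
      t = proj₁ least
      Qt = proj₁ (proj₂ least)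
      below = proj₂ (proj₂ least)

    outside : ∀ S → Subgroup.size S < N → ∃ λ y → ¬ y ∈ₛ S
    outside S size<N with FinP.all? (λ a → enum a ∈ₗ? Subgroup.el S)
    ... | yes cov = contradiction (covering⇒N≤ (Subgroup.el S) cov) (<⇒≱ size<N)
    ... | no ¬cov = missed (Subgroup.el S) ¬cov

    proper : ∀ {p} → Prime p → ∀ S → Subgroup.size S * p ∣ N → Subgroup.size S < N
    proper {p} pr S |S|p∣N = <-≤-trans
      (subst (_< size * p) (*-identityʳ size)
             (*-monoʳ-< size {{>-nonZero size-pos}} (nonTrivial⇒n>1 p {{prime⇒nonTrivial pr}})))
      (∣⇒≤ {{>-nonZero N-pos}} |S|p∣N)
      where
      open Subgroup S
      open SubgroupProperties S

    -- Take y ∉ S, of order t modulo S.  If p ∣ t, then (t / p) · y works.  Otherwise S + ⟨y⟩ is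
    -- strictly larger and still satisfies the hypothesis; a solution z for it gives t · z for S.
    -- The recursion is bounded by f ≥ N - |S|.
    cauchy-modulo-bounded : ∀ f {p} → Prime p → ∀ S → Subgroup.size S * p ∣ N → N ∸ Subgroup.size S ≤ f
                            → ∃ λ y → ¬ y ∈ₛ S × p · y ∈ₛ S
    cauchy-modulo-bounded zero pr S |S|p∣N room =
      contradiction (m∸n≡0⇒m≤n (n≤0⇒n≡0 room)) (<⇒≱ (proper pr S |S|p∣N))
    cauchy-modulo-bounded (suc f) {p} pr S |S|p∣N room = by-divisibility (p ∣? t)
      where
      open Subgroup S
      open SubgroupProperties S
      y = proj₁ (outside S (proper pr S |S|p∣N))
      y∉ = proj₂ (outside S (proper pr S |S|p∣N))
      t = proj₁ (orderModulo S y)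
      y-mod = proj₂ (orderModulo S y)
      open OrderModulo y-mod

      by-divisibility : Dec (p ∣ t) → ∃ λ y → ¬ y ∈ₛ S × p · y ∈ₛ S
      by-divisibility (yes (divides q t≡qp)) = q · y , minimal q 0<q q<t , ∈-resp t·y≈p·q·y in-S
        where
        0<q = pos-factorˡ pos t≡qp
        q<t : q < t
        q<t = subst (q <_) (≡.sym t≡qp) (m<m*n q p {{>-nonZero 0<q}} (nonTrivial⇒n>1 p {{prime⇒nonTrivial pr}}))
        t·y≈p·q·y : t · y ≈ p · q · y
        t·y≈p·q·y = ≈-trans (×-congˡ (≡.trans t≡qp (*-comm q p))) (≈-sym (×-assocˡ y p q))
      by-divisibility (no p∤t) = t · z , t·z∉ , ∈-resp (·-swap t p z) (S⁺.t·∈S p·z∈)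
        where
        module S⁺ = Adjoin S y t y-mod
        module S⁺P = SubgroupProperties S⁺.adjoined
        p⊥t : Coprime p t
        p⊥t with prime-∣⊎coprime t pr
        ... | inj₁ p∣t = contradiction p∣t p∤t
        ... | inj₂ p⊥t = p⊥t
        |S⁺|p∣N : t * size * p ∣ N
        |S⁺|p∣N = coprime-extension-∣ size-pos p⊥t |S|p∣N (lagrange S⁺.adjoined)
        1<t : 1 < t
        1<t = pos∧≢1⇒≥2 pos λ t≡1 → y∉ (∈-resp (≈-trans (×-congˡ t≡1) (identityʳ y)) in-S)
        size<size⁺ : size < t * size
        size<size⁺ = subst (_< t * size) (*-identityˡ size) (*-monoˡ-< size {{>-nonZero size-pos}} 1<t)
        room' : N ∸ (t * size) ≤ f
        room' = ≤-pred (≤-trans (∸-monoʳ-< size<size⁺ (injective⇒≤N S⁺.el⁺ S⁺.injective⁺)) room)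
        found = cauchy-modulo-bounded f pr S⁺.adjoined |S⁺|p∣N room'
        z = proj₁ found
        z∉ = proj₁ (proj₂ found)
        p·z∈ = proj₂ (proj₂ found)
        t·z∉ : ¬ t · z ∈ₛ S
        t·z∉ t·z∈ = z∉ (S⁺P.coprime-multiples⇒∈ (Coprime.sym p⊥t) (S⁺.⊆adjoined t·z∈) p·z∈)

    cauchy-modulo : ∀ {p} → Prime p → ∀ S → Subgroup.size S * p ∣ N → ∃ λ y → ¬ y ∈ₛ S × p · y ∈ₛ S
    cauchy-modulo pr S |S|p∣N = cauchy-modulo-bounded _ pr S |S|p∣N ≤-refl

    open Exponent exponent

    -- The exponent divides N: ⟨x⟩ = {0} + ⟨x⟩ is a subgroup of size M.
    M∣N : M ∣ N
    M∣N = subst (_∣ N) (*-identityʳ M)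
            (lagrange (Adjoin.adjoined trivial x M (disjoint⇒orderModulo x-order (trivial-disjoint x))))

    record Complement (j : ℕ) : Set (c ⊔ˡ ℓ) where
      field
        K        : Subgroup
        size≡    : Subgroup.size K ≡ j
        disjoint : Disjoint K x

    -- Inside H = K + ⟨x⟩,
    -- Cauchy gives y ∉ H with p · y ∈ H; correcting y by an element of H yields a generator
    -- y' ∉ H with p · y' ∈ K, and then K + ⟨y'⟩ has size p j and still meets ⟨x⟩ trivially.
    module Extension {j p} (pr : Prime p) (C : Complement j) where
      open Complement C
      open Subgroup K
      module KP = SubgroupProperties K
      module H⁺ = Adjoin K x M (disjoint⇒orderModulo x-order disjoint)
      H = H⁺.adjoined
      module HP = SubgroupProperties H

      Generator : Set (c ⊔ˡ ℓ)
      Generator = ∃ λ y' → ¬ y' ∈ₛ H × p · y' ∈ₛ K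

      -- p ⊥ M: take y' = M · y; then p · y' = M · (p · y) ∈ K, and y' ∈ H would force y ∈ H.
      generator-coprime : Coprime p M → ∀ {y} → ¬ y ∈ₛ H → p · y ∈ₛ H → Generator
      generator-coprime p⊥M {y} y∉H p·y∈H = M · y , M·y∉H , KP.∈-resp (·-swap M p y) (H⁺.t·∈S p·y∈H)
        where
        M·y∉H : ¬ M · y ∈ₛ H
        M·y∉H M·y∈H = y∉H (HP.coprime-multiples⇒∈ p⊥M p·y∈H M·y∈H)

      -- M = μ p: write p · y = k + s · x.  Then (μ s) · x = -μ k ∈ K ∩ ⟨x⟩ vanishes, so
      -- M ∣ μ s, i.e. s = σ p, and y' = y - σ · x has p · y' = k.
      generator-divisor : ∀ {μ} → M ≡ μ * p → ∀ {y} → ¬ y ∈ₛ H → p · y ∈ₛ H → Generator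
      generator-divisor {μ} M≡μp {y} y∉H (k , p·y≈) = y ∙ (σ · x) ⁻¹ , y'∉H , (i , p·y'≈el-i)
        where
        i = H⁺.base k
        s = H⁺.coeff k
        μk∈K : (μ · el i) ⁻¹ ∈ₛ K
        μk∈K = KP.⁻¹∈ (KP.·∈ μ (i , ≈-refl))
        μk≈ : (μ · el i) ⁻¹ ≈ (μ * s) · x
        μk≈ = ≈-sym (inverseʳ-unique _ _ (begin
          μ · el i ∙ (μ * s) · x   ≈⟨ ∙-congˡ (×-assocˡ x μ s) ⟨
          μ · el i ∙ μ · s · x     ≈⟨ ×-distrib-+ _ _ μ ⟨
          μ · (el i ∙ s · x)       ≈⟨ ×-congʳ μ p·y≈ ⟨
          μ · p · y                ≈⟨ ×-assocˡ y μ p ⟩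
          (μ * p) · y              ≈⟨ ×-congˡ M≡μp ⟨
          M · y                    ≈⟨ M-kills y ⟩
          ε                        ∎))
        p∣s : p ∣ s
        p∣s = *-cancelˡ-∣ μ {{>-nonZero (pos-factorˡ (IsOrder.pos x-order) M≡μp)}}
                (subst (_∣ μ * s) M≡μp (IsOrder.least x-order (μ * s)
                  (≈-trans (≈-sym μk≈) (disjoint μk∈K (μ * s) μk≈))))
        σ = quotient p∣s
        pσ≡s : p * σ ≡ s
        pσ≡s = ≡.trans (*-comm p σ) (≡.sym (_∣_.equality p∣s))
        y'∉H : ¬ y ∙ (σ · x) ⁻¹ ∈ₛ H
        y'∉H y'∈H = y∉H (HP.∈-resp (≈-trans (assoc _ _ _) (≈-trans (∙-congˡ (inverseˡ _)) (identityʳ y)))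
                                   (HP.∙∈ y'∈H (HP.·∈ σ H⁺.y∈adjoined)))
        p·y'≈el-i : p · (y ∙ (σ · x) ⁻¹) ≈ el i
        p·y'≈el-i = begin
          p · (y ∙ (σ · x) ⁻¹)         ≈⟨ ×-distrib-+ _ _ p ⟩
          p · y ∙ p · ((σ · x) ⁻¹)     ≈⟨ ∙-cong p·y≈ (≈-trans (·-⁻¹ p (σ · x)) (⁻¹-cong (×-assocˡ x p σ))) ⟩
          el i ∙ s · x ∙ ((p * σ) · x) ⁻¹  ≈⟨ ∙-congˡ (⁻¹-cong (×-congˡ pσ≡s)) ⟩
          el i ∙ s · x ∙ (s · x) ⁻¹    ≈⟨ xy∙y⁻¹≈x _ _ ⟩
          el i                         ∎

      generator : M * j * p ∣ N → Generator
      generator Mjp∣N = correct (prime-∣⊎coprime M pr)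
        where
        found = cauchy-modulo pr H (subst (λ s → M * s * p ∣ N) (≡.sym size≡) Mjp∣N)
        y∉H = proj₁ (proj₂ found)
        p·y∈H = proj₂ (proj₂ found)
        correct : p ∣ M ⊎ Coprime p M → Generator
        correct (inj₁ (divides μ M≡μp)) = generator-divisor {μ} M≡μp y∉H p·y∈H
        correct (inj₂ p⊥M)              = generator-coprime p⊥M y∉H p·y∈H

      module Extended (y' : Carrier) (y'∉H : ¬ y' ∈ₛ H) (p·y'∈K : p · y' ∈ₛ K) where
        -- No multiple s · y' with 0 < s < p lies in H (else y' ∈ H, as s ⊥ p).
        below-p∉H : ∀ s → 0 < s → s < p → ¬ s · y' ∈ₛ H
        below-p∉H s 0<s s<p s·y'∈H = y'∉H (HP.coprime-multiples⇒∈ (Coprime.sym (prime⇒coprime pr {{>-nonZero 0<s}} s<p))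
                                                                   s·y'∈H (H⁺.⊆adjoined p·y'∈K))
        y'-mod : OrderModulo K y' p
        y'-mod = record
          { pos = ≤-trans (s≤s z≤n) (nonTrivial⇒n>1 p {{prime⇒nonTrivial pr}}) ; in-S = p·y'∈K
          ; minimal = λ s 0<s s<p s·y'∈K → below-p∉H s 0<s s<p (H⁺.⊆adjoined s·y'∈K) }
        module K⁺ = Adjoin K y' p y'-mod

        -- An element k + s · y' of K + ⟨y'⟩ lying in ⟨x⟩ ⊆ H has s = 0, so it lies in K ∩ ⟨x⟩.
        disjoint⁺ : Disjoint K⁺.adjoined x
        disjoint⁺ {g} (k , g≈) n g≈n·x = by-coefficient (K⁺.coeff k) (FinP.toℕ<n (proj₁ (K⁺.position k))) g≈
          where
          i = K⁺.base k
          by-coefficient : ∀ s → s < p → g ≈ el i ∙ s · y' → g ≈ ε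
          by-coefficient zero _ g≈el-i∙ε = ≈-trans g≈el-i (disjoint (i , ≈-refl) n (≈-trans (≈-sym g≈el-i) g≈n·x))
            where g≈el-i = ≈-trans g≈el-i∙ε (identityʳ _)
          by-coefficient (suc s) s<p g≈ = contradiction s·y'∈H (below-p∉H (suc s) (s≤s z≤n) s<p)
            where
            g∈H : g ∈ₛ H
            g∈H = HP.∈-resp (≈-trans (identityˡ _) (≈-sym g≈n·x)) (H⁺.∈⁺ n ε∈)
            s·y'∈H = HP.∈-resp (≈-trans (∙-congʳ g≈) (xyx⁻¹≈y _ _)) (HP.-∈ g∈H (H⁺.⊆adjoined (i , ≈-refl)))

        complement⁺ : Complement (p * j)
        complement⁺ = record { K = K⁺.adjoined ; size≡ = cong (p *_) size≡ ; disjoint = disjoint⁺ }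

    extend-complement : ∀ {j p} → Prime p → Complement j → M * j * p ∣ N → Complement (p * j)
    extend-complement pr C Mjp∣N = Extended.complement⁺ y' y'∉H p·y'∈K
      where
      open Extension pr C
      y' = proj₁ (generator Mjp∣N)
      y'∉H = proj₁ (proj₂ (generator Mjp∣N))
      p·y'∈K = proj₂ (proj₂ (generator Mjp∣N))

    trivial-complement : Complement 1
    trivial-complement = record { K = trivial ; size≡ = refl ; disjoint = trivial-disjoint x }

    complement-by : ∀ {j} ps → All Prime ps → Complement j → M * (j * product ps) ∣ N → Complement (j * product ps)
    complement-by {j} []       []          C _        = subst Complement (≡.sym (*-identityʳ j)) C
    complement-by {j} (p ∷ ps) (pr ∷ prs) C Mj∏∣N =
      subst Complement (≡.sym (regroup-size j p (product ps)))
        (complement-by ps prs (extend-complement pr C Mjp∣N)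
                       (subst (λ s → M * s ∣ N) (regroup-size j p (product ps)) Mj∏∣N))
      where
      Mjp∣N : M * j * p ∣ N
      Mjp∣N = ∣-trans (divides (product ps) (regroup-divisor M j p (product ps))) Mj∏∣N

    -- There is a complement of every size j > 0 with M j ∣ N: extend the trivial one
    -- by the prime factors of j.
    complement : ∀ {j} → 0 < j → M * j ∣ N → Complement j
    complement {j} 0<j Mj∣N =
      subst Complement 1*∏≡j (complement-by factors factorsPrime trivial-complement
                                             (subst (λ s → M * s ∣ N) (≡.sym 1*∏≡j) Mj∣N))
      where
      open PrimeFactorisation (factorise j {{>-nonZero 0<j}})
      1*∏≡j : 1 * product factors ≡ j
      1*∏≡j = ≡.trans (*-identityˡ _) (≡.sym isFactorisation)

theorem1p4 : {c ℓ : Level} (G : AbelianGroup c ℓ) (N : ℕ) (fin : HasOrder G N)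
    (o : Fin N → ℕ) → (∀ i → IsElemOrder G (HasOrder.enum fin i) (o i))
    → (e : ℕ) → e ≡ lcmFin N o
    → (r : ℕ) → 1 ≤ r → r ≤ N
    → (d₁ d₂ : ℕ) → d₁ ∈D (N div e) → d₂ ∈D e → r ≤ d₁ * e
    → RhoMinusAtMost G r ((d₁ * d₂) * (2 * ceilDiv r (d₁ * d₂) ∸ 1))
theorem1p4 G N fin o ho e e≡lcm r _ _ d₁ d₂ (0<d₁ , d₁∣N/e) (0<d₂ , d₂∣e) r≤d₁e =
  subst (λ h → RhoMinusAtMost G r (h * (2 * ceilDiv r h ∸ 1))) |H|≡d₁d₂ progression-set
  where
  open GroupTheory G
  open Finite N fin o ho
  open Exponent exponent
  e≡M : e ≡ M
  e≡M = ≡.trans e≡lcm M≡lcm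
  d₂∣M = subst (d₂ ∣_) e≡M d₂∣e
  μ = quotient d₂∣M
  M≡μd₂ : M ≡ μ * d₂
  M≡μd₂ = _∣_.equality d₂∣M
  Md₁∣N : M * d₁ ∣ N
  Md₁∣N = subst (_∣ N) (*-comm d₁ M)
                (∣-div⇒*∣ (IsOrder.pos x-order) M∣N (subst (λ e → d₁ ∣ N div e) e≡M d₁∣N/e))
  open Complement (complement 0<d₁ Md₁∣N)
  open Stacked K x μ d₂ (pos-factorˡ (IsOrder.pos x-order) M≡μd₂) 0<d₂ (subst (IsOrder x) M≡μd₂ x-order) disjoint
  |H|≡d₁d₂ : Subgroup.size H ≡ d₁ * d₂
  |H|≡d₁d₂ = ≡.trans (cong (d₂ *_) size≡) (*-comm d₂ d₁)
  r≤μ|H| : r ≤ μ * Subgroup.size H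
  r≤μ|H| = subst (r ≤_) (≡.trans (cong (d₁ *_) (≡.trans e≡M M≡μd₂))
                            (≡.trans (rotate-product d₁ μ d₂) (cong (λ s → μ * (d₂ * s)) (≡.sym size≡)))) r≤d₁e
  open Progression H x μ x-mod r r≤μ|H|
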